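{- Let $\pi=\pi_1\cdots\pi_n$ be a left-crucial permutation with respect to squares. Index the entries of any extension of $\pi$ to the left by positions $0,1,\dots,n$ (the new element in position $0$). Suppose that for some extension to the left of $\pi$, the factor in positions $0,\dots,7$ is order-isomorphic to the factor in positions $8,\dots,15$ (a square of length $16$). Then there is no extension to the left of $\pi$ in which the factor in positions $0,\dots,11$ is order-isomorphic to the factor in positions $12,\dots,23$ (a square of length $24$).
   Context: Permutations are written in one-line notation. A factor is a sequence of consecutive entries; two sequences of distinct numbers of equal length are order-isomorphic if their entries are in the same relative order. A square is a factor $XY$ with $X,Y$ consecutive, of equal length at least $2$, and order-isomorphic; its length is $2|X|$. A permutation is square-free if it contains no square. For $\pi=\pi_1\cdots\pi_n$ and $x\in\{1,\dots,n+1\}$, the extension of $\pi$ to the left by $x$ is the permutation $x\pi'_1\cdots\pi'_n$ where $\pi'_j=\pi_j$ if $\pi_j<x$ and $\pi'_j=\pi_j+1$ otherwise. A permutation is left-crucial with respect to squares if it is square-free but every extension of it to the left by every $x\in\{1,\dots,n+1\}$ contains a square. -}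

module Defs where

open import Data.Nat using (ℕ; zero; suc; _+_; _*_; _≤_; _<_; _<ᵇ_)
open import Data.List using (List; []; _∷_; length; map; take; drop)
open import Data.List.Relation.Unary.All using (All)
open import Data.List.Relation.Unary.Unique.Propositional using (Unique)
open import Data.Product using (_×_; Σ; ∃; _,_)
open import Data.Bool using (if_then_else_)
open import Data.Maybe using (Maybe; just)
open import Relation.Binary.PropositionalEquality using (_≡_)
open import Relation.Nullary using (¬_)
open import Function.Bundles using (_⇔_)

IsPerm : ℕ → List ℕ → Set
IsPerm n xs = (length xs ≡ n) × Unique xs × All (λ v → 1 ≤ v × v ≤ n) xs

at : List ℕ → ℕ → Maybe ℕ
at [] _ = Data.Maybe.nothing
at (x ∷ xs) zero = just x
at (x ∷ xs) (suc i) = at xs i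

OrderIso : List ℕ → List ℕ → Set
OrderIso xs ys =
  (length xs ≡ length ys) ×
  (∀ i j a b c d → at xs i ≡ just a → at xs j ≡ just b →
                   at ys i ≡ just c → at ys j ≡ just d →
                   (a < b ⇔ c < d))

factor : ℕ → ℕ → List ℕ → List ℕ
factor i k xs = take k (drop i xs)

SquareAt : List ℕ → ℕ → ℕ → Set
SquareAt σ i k = (2 ≤ k) × (i + 2 * k ≤ length σ) ×
                 OrderIso (factor i k σ) (factor (i + k) k σ)

ContainsSquare : List ℕ → Set
ContainsSquare σ = Σ ℕ λ i → Σ ℕ λ k → SquareAt σ i k

SquareFree : List ℕ → Set
SquareFree σ = ¬ ContainsSquare σ

extL : ℕ → List ℕ → List ℕ
extL x π = x ∷ map (λ v → if v <ᵇ x then v else suc v) π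

LeftCrucial : ℕ → List ℕ → Set
LeftCrucial n π = SquareFree π ×
  (∀ x → 1 ≤ x → x ≤ suc n → ContainsSquare (extL x π))

-- Some extension to the left of π has a square of length 2k starting at position 0.
HasLeftSquare : ℕ → List ℕ → ℕ → Set
HasLeftSquare n π k = Σ ℕ λ x → (1 ≤ x) × (x ≤ suc n) × SquareAt (extL x π) 0 k

-- Restricting a left square of half-length k to positions 1,…,m of each half
-- skips the new first entry, so for m < k it yields an order-isomorphism
-- π[0,m) ≅ π[k,k+m) between windows of π itself (0-indexed, half-open).
-- Doing this for left squares of half-lengths k and k + m makes both
-- π[k,k+m) and π[k+m,k+2m) order-isomorphic to the prefix π[0,m), so π
-- contains a square; for k = 8, m = 4 this contradicts square-freeness.
module Submission where

open import Defs
open import Data.Nat using (ℕ; zero; suc; _+_; _*_; _≤_; _<_; _<ᵇ_; z≤n; s≤s; _∸_; _⊓_)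
open import Data.Nat.Properties
open import Data.Nat.Tactic.RingSolver using (solve-∀)
open import Data.List using (List; []; _∷_; length; map; take; drop)
open import Data.List.Properties using (length-map; length-take; length-drop; take-map; drop-map; take-drop; take-take; drop-drop)
open import Data.Bool using (true; false; T; if_then_else_)
open import Data.Maybe using (just)
open import Data.Product using (∃; _,_)
open import Data.Empty using (⊥-elim)
open import Relation.Binary using (tri<; tri≈; tri>)
open import Relation.Binary.PropositionalEquality
open import Relation.Nullary using (¬_)
open import Relation.Nullary.Decidable using (from-yes)
open import Function.Bundles using (_⇔_; mk⇔)
import Function.Properties.Equivalence as ⇔

at-drop : ∀ i xs u → at (drop i xs) u ≡ at xs (i + u)
at-drop zero    xs       u = refl
at-drop (suc i) []       u = refl
at-drop (suc i) (x ∷ xs) u = at-drop i xs u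

at-take-just : ∀ k xs u {a} → at (take k xs) u ≡ just a → at xs u ≡ just a
at-take-just (suc k) (x ∷ xs) zero    e = e
at-take-just (suc k) (x ∷ xs) (suc u) e = at-take-just k xs u e

at-factor-just : ∀ i k xs u {a} → at (factor i k xs) u ≡ just a → at xs (i + u) ≡ just a
at-factor-just i k xs u e = trans (sym (at-drop i xs u)) (at-take-just k (drop i xs) u e)

at-map-just : ∀ (f : ℕ → ℕ) xs u {a} → at xs u ≡ just a → at (map f xs) u ≡ just (f a)
at-map-just f (x ∷ xs) zero    refl = refl
at-map-just f (x ∷ xs) (suc u) e    = at-map-just f xs u e

at-just-sameLength : ∀ xs ys u {a} → length xs ≡ length ys → at xs u ≡ just a →
                     ∃ λ c → at ys u ≡ just c
at-just-sameLength (x ∷ xs) (y ∷ ys) zero    _   _ = y , refl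
at-just-sameLength (x ∷ xs) (y ∷ ys) (suc u) len e = at-just-sameLength xs ys u (suc-injective len) e

factor-factor : ∀ i j k m xs → j + k ≤ m → factor j k (factor i m xs) ≡ factor (j + i) k xs
factor-factor i j k m xs j+k≤m = begin
  take k (drop j (take m ys))          ≡⟨ take-drop k j (take m ys) ⟩
  drop j (take (j + k) (take m ys))    ≡⟨ cong (drop j) (take-take (j + k) m ys) ⟩
  drop j (take ((j + k) ⊓ m) ys)       ≡⟨ cong (λ l → drop j (take l ys)) (m≤n⇒m⊓n≡m j+k≤m) ⟩
  drop j (take (j + k) ys)             ≡⟨ take-drop k j ys ⟨
  take k (drop j (drop i xs))          ≡⟨ cong (take k) (drop-drop i j xs) ⟩
  take k (drop (i + j) xs)             ≡⟨ cong (λ l → take k (drop l xs)) (+-comm i j) ⟩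
  take k (drop (j + i) xs)             ∎
  where
  open ≡-Reasoning
  ys = drop i xs

OrderIso-sym : ∀ xs ys → OrderIso xs ys → OrderIso ys xs
OrderIso-sym _ _ (len , iso) =
  sym len , λ i j a b c d ea eb ec ed → ⇔.sym (iso i j c d a b ec ed ea eb)

OrderIso-trans : ∀ xs ys zs → OrderIso xs ys → OrderIso ys zs → OrderIso xs zs
OrderIso-trans xs ys zs (len₁ , iso₁) (len₂ , iso₂) =
  trans len₁ len₂ , λ i j a b e f ea eb ee ef →
    let c , ec = at-just-sameLength xs ys i len₁ ea
        d , ed = at-just-sameLength xs ys j len₁ eb
    in ⇔.trans (iso₁ i j a b c d ea eb ec ed) (iso₂ i j c d e f ec ed ee ef)

OrderIso-factor : ∀ xs ys i k → OrderIso xs ys → OrderIso (factor i k xs) (factor i k ys)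
OrderIso-factor xs ys i k (len , iso) =
  lengths , λ u v a b c d ea eb ec ed →
    iso (i + u) (i + v) a b c d
        (at-factor-just i k xs u ea) (at-factor-just i k xs v eb)
        (at-factor-just i k ys u ec) (at-factor-just i k ys v ed)
  where
  lengths : length (factor i k xs) ≡ length (factor i k ys)
  lengths = begin
    length (take k (drop i xs)) ≡⟨ length-take k (drop i xs) ⟩
    k ⊓ length (drop i xs)      ≡⟨ cong (k ⊓_) (length-drop i xs) ⟩
    k ⊓ (length xs ∸ i)         ≡⟨ cong (λ l → k ⊓ (l ∸ i)) len ⟩
    k ⊓ (length ys ∸ i)         ≡⟨ cong (k ⊓_) (length-drop i ys) ⟨
    k ⊓ length (drop i ys)      ≡⟨ length-take k (drop i ys) ⟨
    length (take k (drop i ys)) ∎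
    where open ≡-Reasoning

OrderIso-map⁻ : ∀ {f : ℕ → ℕ} → (∀ a b → (f a < f b) ⇔ (a < b)) →
                ∀ xs ys → OrderIso (map f xs) (map f ys) → OrderIso xs ys
OrderIso-map⁻ {f} f-<-⇔ xs ys (len , iso) =
  trans (sym (length-map f xs)) (trans len (length-map f ys)) ,
  λ i j a b c d ea eb ec ed →
    ⇔.trans (⇔.sym (f-<-⇔ a b))
      (⇔.trans (iso i j (f a) (f b) (f c) (f d)
                   (at-map-just f xs i ea) (at-map-just f xs j eb)
                   (at-map-just f ys i ec) (at-map-just f ys j ed))
               (f-<-⇔ c d))

bump : ℕ → ℕ → ℕ
bump x v = if v <ᵇ x then v else suc v

bump-mono-< : ∀ x {a b} → a < b → bump x a < bump x b
bump-mono-< x {a} {b} a<b with a <ᵇ x in ea | b <ᵇ x in eb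
... | true  | true  = a<b
... | true  | false = m≤n⇒m≤1+n a<b
... | false | true  = ⊥-elim (subst T ea (<⇒<ᵇ (<-trans a<b (<ᵇ⇒< b x (subst T (sym eb) _)))))
... | false | false = s≤s a<b

bump-<-⇔ : ∀ x a b → (bump x a < bump x b) ⇔ (a < b)
bump-<-⇔ x a b = mk⇔ reflect (bump-mono-< x)
  where
  reflect : bump x a < bump x b → a < b
  reflect p with <-cmp a b
  ... | tri< a<b _ _ = a<b
  ... | tri≈ _ refl _ = ⊥-elim (<-irrefl refl p)
  ... | tri> _ _ b<a = ⊥-elim (<-asym p (bump-mono-< x b<a))

factor-extL : ∀ x π i k → factor (suc i) k (extL x π) ≡ map (bump x) (factor i k π)
factor-extL x π i k = trans (cong (take k) (drop-map i π)) (take-map k (drop i π))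

leftSquare⇒prefixIso : ∀ {x π k} m → m < k → SquareAt (extL x π) 0 k →
                       OrderIso (factor 0 m π) (factor k m π)
leftSquare⇒prefixIso {x} {π} {k} m m<k (_ , _ , square) =
  OrderIso-map⁻ (bump-<-⇔ x) (factor 0 m π) (factor k m π)
    (subst₂ OrderIso
      (trans (factor-factor 0 1 m k σ m<k) (factor-extL x π 0 m))
      (trans (factor-factor k 1 m k σ m<k) (factor-extL x π k m))
      (OrderIso-factor (factor 0 k σ) (factor k k σ) 1 m square))
  where σ = extL x π

twoSquares-length : ∀ {k m l} → m < k → 2 * (k + m) ≤ suc l → k + 2 * m ≤ l
twoSquares-length {k} {m} m<k fits = ≤-pred (≤-trans suc-bound fits)
  where
  open ≤-Reasoning
  suc-bound : suc (k + 2 * m) ≤ 2 * (k + m)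
  suc-bound = begin
    suc (k + 2 * m)   ≡⟨ +-comm 1 (k + 2 * m) ⟩
    k + 2 * m + 1     ≤⟨ +-monoʳ-≤ (k + 2 * m) (≤-trans (s≤s z≤n) m<k) ⟩
    k + 2 * m + k     ≡⟨ regroup k m ⟩
    2 * (k + m)       ∎
    where
    regroup : ∀ k m → k + 2 * m + k ≡ 2 * (k + m)
    regroup = solve-∀

leftSquares⇒square : ∀ {x y π k m} → 2 ≤ m → m < k →
                     SquareAt (extL x π) 0 k → SquareAt (extL y π) 0 (k + m) →
                     SquareAt π k m
leftSquares⇒square {y = y} {π} {k} {m} 2≤m m<k shortSquare longSquare@(_ , fits , _) =
  2≤m ,
  twoSquares-length m<k (subst (λ l → 2 * (k + m) ≤ suc l) (length-map (bump y) π) fits) ,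
  first≅second
  where
  prefix first second : List ℕ
  prefix = factor 0 m π
  first  = factor k m π
  second = factor (k + m) m π
  prefix≅first : OrderIso prefix first
  prefix≅first = leftSquare⇒prefixIso m m<k shortSquare
  prefix≅second : OrderIso prefix second
  prefix≅second = leftSquare⇒prefixIso m (m<n+m m (≤-trans (s≤s z≤n) m<k)) longSquare
  first≅second : OrderIso first second
  first≅second = OrderIso-trans first prefix second (OrderIso-sym prefix first prefix≅first) prefix≅second

theorem2 : (n : ℕ) (π : List ℕ) → IsPerm n π → LeftCrucial n π →
           HasLeftSquare n π 8 → ¬ HasLeftSquare n π 12
theorem2 n π _ (squareFree , _) (_ , _ , _ , square₁₆) (_ , _ , _ , square₂₄) =
  squareFree (8 , 4 , leftSquares⇒square (from-yes (2 ≤? 4)) (from-yes (4 <? 8)) square₁₆ square₂₄)
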